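{- Let $G$ be a connected graph containing a vertex $v$ that is incident to at least three non-cut edges. Then there exist two edges $e_1,e_2$ incident to $v$ such that $G-\{e_1,e_2\}$ is connected.
   Context: A cut edge (bridge) of a connected graph is an edge whose removal disconnects the graph; a non-cut edge is an edge that is not a cut edge. $G-\{e_1,e_2\}$ denotes the graph obtained by deleting the edges $e_1,e_2$ (keeping all vertices). -}

module Defs where

open import Level using (0ℓ)
open import Data.Nat using (ℕ)
open import Data.Fin using (Fin)
open import Data.Product using (_×_; _,_)
open import Data.Sum using (_⊎_)
open import Relation.Nullary using (¬_; Dec)
open import Relation.Binary.PropositionalEquality using (_≡_)

record Graph (n : ℕ) : Set₁ where
  field
    Adj     : Fin n → Fin n → Set
    sym     : ∀ {x y} → Adj x y → Adj y x
    irrefl  : ∀ {x} → ¬ Adj x x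
    adj?    : ∀ x y → Dec (Adj x y)
open Graph public

SameEdge : ∀ {n} → Fin n → Fin n → Fin n → Fin n → Set
SameEdge x y a b = (x ≡ a × y ≡ b) ⊎ (x ≡ b × y ≡ a)

deleteEdge : ∀ {n} → Graph n → Fin n → Fin n → Graph n
deleteEdge G a b = record
  { Adj    = λ x y → Adj G x y × ¬ SameEdge x y a b
  ; sym    = λ { (p , q) → sym G p , λ s → q (flipS s) }
  ; irrefl = λ { (p , _) → irrefl G p }
  ; adj?   = λ x y → dec x y
  }
  where
  open import Data.Sum using (inj₁; inj₂)
  open import Relation.Nullary using (yes; no)
  flipS : ∀ {x y} → SameEdge y x a b → SameEdge x y a b
  flipS (inj₁ (p , q)) = inj₂ (q , p)
  flipS (inj₂ (p , q)) = inj₁ (q , p)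
  open import Data.Fin using (_≟_)
  dec : ∀ x y → Dec (Adj G x y × ¬ SameEdge x y a b)
  dec x y with adj? G x y | x ≟ a | y ≟ b | x ≟ b | y ≟ a
  ... | no ¬p | _ | _ | _ | _ = no λ { (p , _) → ¬p p }
  ... | yes p | yes xa | yes yb | _ | _ = no λ { (_ , q) → q (inj₁ (xa , yb)) }
  ... | yes p | _ | _ | yes xb | yes ya = no λ { (_ , q) → q (inj₂ (xb , ya)) }
  ... | yes p | no xa | _ | no xb | _ = yes (p , λ { (inj₁ (e , _)) → xa e ; (inj₂ (e , _)) → xb e })
  ... | yes p | no xa | _ | yes xb | no ya = yes (p , λ { (inj₁ (e , _)) → xa e ; (inj₂ (_ , e)) → ya e })
  ... | yes p | yes xa | no yb | no xb | _ = yes (p , λ { (inj₁ (_ , e)) → yb e ; (inj₂ (e , _)) → xb e })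
  ... | yes p | yes xa | no yb | yes xb | no ya = yes (p , λ { (inj₁ (_ , e)) → yb e ; (inj₂ (_ , e)) → ya e })

data Reach {n} (G : Graph n) : Fin n → Fin n → Set where
  here  : ∀ {x} → Reach G x x
  step  : ∀ {x y z} → Adj G x y → Reach G y z → Reach G x z

Connected : ∀ {n} → Graph n → Set
Connected G = ∀ x y → Reach G x y

IsCutEdge : ∀ {n} → Graph n → Fin n → Fin n → Set
IsCutEdge G a b = Adj G a b × ¬ Connected (deleteEdge G a b)

IsNonCutEdge : ∀ {n} → Graph n → Fin n → Fin n → Set
IsNonCutEdge G a b = Adj G a b × ¬ IsCutEdge G a b

-- Since vx₃ is not a cut edge, some walk from x₃ to v avoids the edge vx₃; let u
-- be the vertex from which it first enters v. If u = x₁, then x₁ reaches x₃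
-- without passing through v and then steps to v, so x₁ and v stay joined in
-- G - {vx₁, vx₂}; otherwise the same walk joins x₃ to v in G - {vx₁, vx₃}.
-- Either way the second deleted edge is not a cut edge of the connected graph
-- obtained by deleting the first one.
module Submission where

open import Defs
open import Data.Nat using (ℕ; zero; suc)
open import Data.Fin using (Fin; punchIn; punchOut; _≟_)
open import Data.Fin.Properties using (any?; all?; punchOut-cong; punchIn-punchOut)
open import Data.Product using (_×_; ∃-syntax; _,_; proj₁)
open import Data.Sum using (_⊎_; inj₁; inj₂)
open import Data.Empty using (⊥-elim)
open import Function using (_∘_)
open import Relation.Nullary using (¬_; Dec; yes; no)
open import Relation.Nullary.Decidable using (_×-dec_; _⊎-dec_; map′)
open import Relation.Binary.PropositionalEquality
  using (_≡_; _≢_; ≢-sym; refl; subst; subst₂) renaming (sym to ≡-sym)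

module _ {n : ℕ} {G : Graph n} where

  adj⇒≢ : ∀ {x y} → Adj G x y → x ≢ y
  adj⇒≢ xy refl = irrefl G xy

  reach-trans : ∀ {x y z} → Reach G x y → Reach G y z → Reach G x z
  reach-trans here       q = q
  reach-trans (step r p) q = step r (reach-trans p q)

  reach-sym : ∀ {x y} → Reach G x y → Reach G y x
  reach-sym here       = here
  reach-sym (step r p) = reach-trans (reach-sym p) (step (sym G r) here)

reach-mono : ∀ {n} {G H : Graph n} → (∀ {x y} → Adj G x y → Adj H x y) →
             ∀ {x y} → Reach G x y → Reach H x y
reach-mono f here       = here
reach-mono f (step r p) = step (f r) (reach-mono f p)

data Avoiding {n} (G : Graph n) (a : Fin n) : Fin n → Fin n → Set where
  here : ∀ {x} → a ≢ x → Avoiding G a x x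
  step : ∀ {x y z} → a ≢ x → Adj G x y → Avoiding G a y z → Avoiding G a x z

module _ {n : ℕ} {G : Graph n} {a : Fin n} where

  avoiding-start : ∀ {x z} → Avoiding G a x z → a ≢ x
  avoiding-start (here a≢x)     = a≢x
  avoiding-start (step a≢x _ _) = a≢x

  avoiding⇒reach : ∀ {x z} → Avoiding G a x z → Reach G x z
  avoiding⇒reach (here _)     = here
  avoiding⇒reach (step _ r w) = step r (avoiding⇒reach w)

  last-exit : ∀ {c b} → Reach G c b → a ≢ b →
              Avoiding G a c b ⊎ ∃[ y ] (Adj G a y × Avoiding G a y b)
  last-exit here a≢b = inj₁ (here a≢b)
  last-exit {c} (step {y = y} r w) a≢b with last-exit w a≢b | a ≟ c
  ... | inj₂ exit | _        = inj₂ exit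
  ... | inj₁ w′   | yes refl = inj₂ (y , r , w′)
  ... | inj₁ w′   | no a≢c   = inj₁ (step a≢c r w′)

  first-arrival : ∀ {c} → Reach G c a → a ≢ c → ∃[ u ] (Avoiding G a c u × Adj G u a)
  first-arrival here a≢a = ⊥-elim (a≢a refl)
  first-arrival {c} (step {y = y} r w) a≢c with a ≟ y
  ... | yes refl = c , here a≢c , r
  ... | no a≢y with first-arrival w a≢y
  ...   | u , w′ , ua = u , step a≢c r w′ , ua

avoiding-mono : ∀ {n} {G H : Graph n} {a} → (∀ {x y} → Adj G x y → Adj H x y) →
                ∀ {x z} → Avoiding G a x z → Avoiding H a x z
avoiding-mono f (here a≢x)     = here a≢x
avoiding-mono f (step a≢x r w) = step a≢x (f r) (avoiding-mono f w)

avoiding-deleteEdge : ∀ {n} {G : Graph n} {v b x z} →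
                      Avoiding G v x z → Avoiding (deleteEdge G v b) v x z
avoiding-deleteEdge (here v≢x) = here v≢x
avoiding-deleteEdge (step v≢x r w) = step v≢x (r , not-at-v) (avoiding-deleteEdge w)
  where
  not-at-v : ¬ SameEdge _ _ _ _
  not-at-v (inj₁ (x≡v , _)) = v≢x (≡-sym x≡v)
  not-at-v (inj₂ (_ , y≡v)) = avoiding-start w (≡-sym y≡v)

avoiding⇒reach-deleteEdge² : ∀ {n} {G : Graph n} {v a b x z} →
                             Avoiding G v x z → Reach (deleteEdge (deleteEdge G v a) v b) x z
avoiding⇒reach-deleteEdge² = avoiding⇒reach ∘ avoiding-deleteEdge ∘ avoiding-deleteEdge

_∖ᵥ_ : ∀ {m} → Graph (suc m) → Fin (suc m) → Graph m
G ∖ᵥ a = record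
  { Adj    = λ x y → Adj G (punchIn a x) (punchIn a y)
  ; sym    = sym G
  ; irrefl = irrefl G
  ; adj?   = λ x y → adj? G (punchIn a x) (punchIn a y)
  }

reach-punchIn : ∀ {m} {G : Graph (suc m)} {a x y} →
                Reach (G ∖ᵥ a) x y → Reach G (punchIn a x) (punchIn a y)
reach-punchIn here       = here
reach-punchIn (step r w) = step r (reach-punchIn w)

avoiding-punchOut : ∀ {m} {G : Graph (suc m)} {a x z} (a≢x : a ≢ x) (a≢z : a ≢ z) →
                    Avoiding G a x z → Reach (G ∖ᵥ a) (punchOut a≢x) (punchOut a≢z)
avoiding-punchOut {G = G} {a} a≢x a≢z (here _) =
  subst (Reach (G ∖ᵥ a) (punchOut a≢x)) (punchOut-cong a refl) here
avoiding-punchOut {G = G} a≢x a≢z (step _ r w) =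
  step (subst₂ (Adj G) (≡-sym (punchIn-punchOut a≢x)) (≡-sym (punchIn-punchOut a≢y)) r)
       (avoiding-punchOut a≢y a≢z w)
  where a≢y = avoiding-start w

-- After its last visit to a, a walk from a lies in G ∖ᵥ a; so recurse on the number of vertices.
reach? : ∀ {n} (G : Graph n) x y → Dec (Reach G x y)
reach? {zero}  G () _
reach? {suc m} G a b with a ≟ b
... | yes refl = yes here
... | no a≢b   = map′ leave-a via-last-exit
      (any? λ y → adj? G a (punchIn a y) ×-dec reach? (G ∖ᵥ a) y (punchOut a≢b))
  where
  leave-a : ∃[ y ] (Adj G a (punchIn a y) × Reach (G ∖ᵥ a) y (punchOut a≢b)) → Reach G a b
  leave-a (y , r , w) = step r (subst (Reach G _) (punchIn-punchOut a≢b) (reach-punchIn w))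

  via-last-exit : Reach G a b → ∃[ y ] (Adj G a (punchIn a y) × Reach (G ∖ᵥ a) y (punchOut a≢b))
  via-last-exit w with last-exit w a≢b
  ... | inj₁ w′ = ⊥-elim (avoiding-start w′ refl)
  ... | inj₂ (y , r , w′) =
    punchOut a≢y , subst (Adj G a) (≡-sym (punchIn-punchOut a≢y)) r , avoiding-punchOut a≢y a≢b w′
    where a≢y = avoiding-start w′

connected? : ∀ {n} (G : Graph n) → Dec (Connected G)
connected? G = all? λ x → all? λ y → reach? G x y

-- ¬ IsCutEdge only yields ¬ ¬ Connected; decidability removes the double negation.
nonCutEdge⇒connected : ∀ {n} {G : Graph n} {a b} →
                       IsNonCutEdge G a b → Connected (deleteEdge G a b)
nonCutEdge⇒connected {G = G} {a} {b} (ab , ¬cut) with connected? (deleteEdge G a b)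
... | yes conn = conn
... | no ¬conn = ⊥-elim (¬cut (ab , ¬conn))

sameEdge? : ∀ {n} (x y a b : Fin n) → Dec (SameEdge x y a b)
sameEdge? x y a b = ((x ≟ a) ×-dec (y ≟ b)) ⊎-dec ((x ≟ b) ×-dec (y ≟ a))

deleteEdge-swap : ∀ {n} {G : Graph n} {a b c d x y} →
                  Adj (deleteEdge (deleteEdge G a b) c d) x y →
                  Adj (deleteEdge (deleteEdge G c d) a b) x y
deleteEdge-swap ((r , ¬ab) , ¬cd) = (r , ¬cd) , ¬ab

deleteEdge-keeps-into : ∀ {n} {G : Graph n} {v b x} →
                        Adj G x v → x ≢ b → Adj (deleteEdge G v b) x v
deleteEdge-keeps-into {G = G} xv x≢b = xv , λ
  { (inj₁ (x≡v , _)) → adj⇒≢ {G = G} xv x≡v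
  ; (inj₂ (x≡b , _)) → x≢b x≡b }

deleteEdge-connected : ∀ {n} {G : Graph n} {v x} → Connected G →
                       Reach (deleteEdge G v x) x v → Connected (deleteEdge G v x)
deleteEdge-connected {G = G} {v} {x} conn x⇝v p q = reroute (conn p q)
  where
  edge : ∀ {y z} → Adj G y z → Reach (deleteEdge G v x) y z
  edge {y} {z} r with sameEdge? y z v x
  ... | no ¬vx                 = step (r , ¬vx) here
  ... | yes (inj₁ (refl , refl)) = reach-sym x⇝v
  ... | yes (inj₂ (refl , refl)) = x⇝v

  reroute : ∀ {y z} → Reach G y z → Reach (deleteEdge G v x) y z
  reroute here       = here
  reroute (step r w) = reach-trans (edge r) (reroute w)

first-entry-dichotomy :
  ∀ {n} {G : Graph n} {v x₁ x₂ x₃} → x₁ ≢ x₃ → x₂ ≢ x₃ → Adj G v x₃ →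
  Reach (deleteEdge G v x₃) x₃ v →
  Reach (deleteEdge (deleteEdge G v x₁) v x₂) x₁ v ⊎
  Reach (deleteEdge (deleteEdge G v x₁) v x₃) x₃ v
first-entry-dichotomy {G = G} {v} {x₁} {x₂} {x₃} x₁≢x₃ x₂≢x₃ vx₃ w
  with first-arrival w (adj⇒≢ {G = G} vx₃)
... | u , x₃⇝u , uv , ¬vx₃ with u ≟ x₁
...   | yes refl = inj₁ (reach-trans (reach-sym x₃⇝x₁) (step x₃v here))
  where
  x₃⇝x₁ = avoiding⇒reach-deleteEdge² (avoiding-mono {H = G} proj₁ x₃⇝u)
  x₃v : Adj (deleteEdge (deleteEdge G v x₁) v x₂) x₃ v
  x₃v = deleteEdge-keeps-into {G = deleteEdge G v x₁}
          (deleteEdge-keeps-into {G = G} (sym G vx₃) (≢-sym x₁≢x₃)) (≢-sym x₂≢x₃)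
...   | no u≢x₁  = inj₂ (reach-trans x₃⇝u′ (step uv′ here))
  where
  x₃⇝u′ = avoiding⇒reach-deleteEdge² (avoiding-mono {H = G} proj₁ x₃⇝u)
  uv′ : Adj (deleteEdge (deleteEdge G v x₁) v x₃) u v
  uv′ = deleteEdge-keeps-into {G = G} uv u≢x₁ , ¬vx₃

lemma2p6 : ∀ {n} (G : Graph n) → Connected G → (v x₁ x₂ x₃ : Fin n) →
    ¬ x₁ ≡ x₂ → ¬ x₁ ≡ x₃ → ¬ x₂ ≡ x₃ →
    IsNonCutEdge G v x₁ → IsNonCutEdge G v x₂ → IsNonCutEdge G v x₃ →
    ∃[ y₁ ] ∃[ y₂ ] (¬ y₁ ≡ y₂ × Adj G v y₁ × Adj G v y₂ ×
      Connected (deleteEdge (deleteEdge G v y₁) v y₂))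
lemma2p6 G _ v x₁ x₂ x₃ x₁≢x₂ x₁≢x₃ x₂≢x₃ nc₁ nc₂ nc₃
  with first-entry-dichotomy x₁≢x₃ x₂≢x₃ (proj₁ nc₃) (nonCutEdge⇒connected nc₃ x₃ v)
... | inj₁ x₁⇝v =
  x₁ , x₂ , x₁≢x₂ , proj₁ nc₁ , proj₁ nc₂ , λ p q →
    reach-mono (deleteEdge-swap {G = G})
      (deleteEdge-connected (nonCutEdge⇒connected nc₂)
        (reach-mono (deleteEdge-swap {G = G}) x₁⇝v) p q)
... | inj₂ x₃⇝v =
  x₁ , x₃ , x₁≢x₃ , proj₁ nc₁ , proj₁ nc₃ ,
    deleteEdge-connected (nonCutEdge⇒connected nc₁) x₃⇝v
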